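{- Let $R$ be a finite group, $Q$ a subgroup of $R$, and $QxQ$ a double coset with $|QxQ|=b|Q|$. Let $\mathcal{N}$ be the set of subsets $S\subseteq QxQ$ that intersect $QxQ$ evenly. Then $|\mathcal{N}|\leq 2^{|QxQ|-b+1}$.
   Context: If $\Delta$ is a union of right $Q$-cosets $\Lambda_1,\dots,\Lambda_b$, then $S$ intersects $\Delta$ evenly if $|S\cap\Lambda_1|=\dots=|S\cap\Lambda_b|$. -}

module Defs where

open import Data.Nat using (ℕ; zero; suc; _*_; _∸_; _+_; _^_; _≤_)
open import Data.Nat.Properties using (_≟_)
open import Data.Fin using (Fin)
import Data.Fin.Properties as FinP
open import Data.Fin.Subset using (Subset; _∈_; _⊆_; _∩_; ∣_∣; inside; outside)
open import Data.Fin.Subset.Properties using (_∈?_; _⊆?_)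
open import Data.Vec using ([]; _∷_; tabulate)
open import Data.List using (List; []; _∷_; map; _++_; filter; length)
open import Data.Product using (_×_; _,_; ∃)
open import Relation.Binary.PropositionalEquality using (_≡_)
open import Relation.Nullary using (Dec; does; yes; no; _×-dec_; ¬_)
open import Relation.Nullary.Decidable using (map′)
open import Relation.Unary using (Decidable)
open import Algebra.Structures using (IsGroup)

record FinGroup (n : ℕ) : Set where
  field
    _∙_     : Fin n → Fin n → Fin n
    ε       : Fin n
    _⁻¹     : Fin n → Fin n
    isGroup : IsGroup _≡_ _∙_ ε _⁻¹

record IsSubgroup {n : ℕ} (R : FinGroup n) (Q : Subset n) : Set where
  open FinGroup R
  field
    ε∈      : ε ∈ Q
    ∙-closed : ∀ {a b} → a ∈ Q → b ∈ Q → (a ∙ b) ∈ Q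
    ⁻¹-closed : ∀ {a} → a ∈ Q → (a ⁻¹) ∈ Q

module _ {n : ℕ} (R : FinGroup n) (Q : Subset n) where
  open FinGroup R

  doubleCoset : Fin n → Subset n
  doubleCoset x = tabulate λ g →
    if? (FinP.any? λ q₁ → FinP.any? λ q₂ →
          (q₁ ∈? Q) ×-dec ((q₂ ∈? Q) ×-dec ((q₁ ∙ x) ∙ q₂ FinP.≟ g)))
    where
      if? : ∀ {P : Set} → Dec P → _
      if? (yes _) = inside
      if? (no _)  = outside

  rightCoset : Fin n → Subset n
  rightCoset y = tabulate λ g →
    if? (FinP.any? λ q → (q ∈? Q) ×-dec (q ∙ y FinP.≟ g))
    where
      if? : ∀ {P : Set} → Dec P → _
      if? (yes _) = inside
      if? (no _)  = outside

  -- S intersects QxQ evenly: QxQ is the union of the right Q-cosets Qy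
  -- (y ∈ QxQ), and S meets all of them in the same number of elements.
  IntersectsEvenly : Fin n → Subset n → Set
  IntersectsEvenly x S = ∀ y z → y ∈ doubleCoset x → z ∈ doubleCoset x →
    ∣ S ∩ rightCoset y ∣ ≡ ∣ S ∩ rightCoset z ∣

  intersectsEvenly? : (x : Fin n) → Decidable (IntersectsEvenly x)
  intersectsEvenly? x S = FinP.all? λ y → FinP.all? λ z →
    dec→ (y ∈? doubleCoset x) (dec→ (z ∈? doubleCoset x)
      (∣ S ∩ rightCoset y ∣ ≟ ∣ S ∩ rightCoset z ∣))
    where
      dec→ : ∀ {A B : Set} → Dec A → Dec B → Dec (A → B)
      dec→ _       (yes b) = yes λ _ → b
      dec→ (yes a) (no ¬b) = no λ f → ¬b (f a)
      dec→ (no ¬a) _       = yes λ a → Data.Empty.⊥-elim (¬a a)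
        where import Data.Empty

allSubsets : (n : ℕ) → List (Subset n)
allSubsets zero    = [] ∷ []
allSubsets (suc n) = map (inside ∷_) (allSubsets n) ++ map (outside ∷_) (allSubsets n)

module _ {n : ℕ} (R : FinGroup n) (Q : Subset n) where
  evenSubsets : Fin n → List (Subset n)
  evenSubsets x = filter (λ S → (S ⊆? doubleCoset R Q x) ×-dec intersectsEvenly? R Q x S)
                         (allSubsets n)

-- The double coset QxQ is the disjoint union of the right cosets Qy it contains, and
-- since each of them has at most |Q| elements there are at least b of them. Choose an
-- element in each of these cosets except the one containing x (here: its least element),
-- and let T be QxQ without the chosen elements, so that |T| ≤ |QxQ| − b + 1. If S ⊆ QxQ
-- intersects QxQ evenly, then S ∩ T determines S: it determines S ∩ Qx, hence the common
-- size of all the S ∩ Qy, and each S ∩ Qy is known except at its chosen element. So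
-- S ↦ S ∩ T is injective on 𝒩 and |𝒩| ≤ 2^|T|.

module Submission where

open import Defs
open import Data.Nat using (ℕ; zero; suc; _+_; _*_; _∸_; _^_; _≤_; _<_; z≤n; s≤s; >-nonZero)
open import Data.Nat.Properties as ℕ using ()
open import Data.Bool using (Bool; true; false)
open import Data.Fin using (Fin; zero; suc)
import Data.Fin as Fin
import Data.Fin.Properties as FinP
open import Data.Fin.Induction using (<-wellFounded)
open import Data.Fin.Subset
  using (Subset; _∈_; _∉_; _⊆_; _∩_; _∪_; _─_; ⁅_⁆; ∣_∣)
open import Data.Fin.Subset.Properties
  using (_∈?_; _⊆?_; drop-∷-⊆; ⊆-antisym; p∩q⊆q; x∈p∩q⁺; x∈p∩q⁻; x∈p∪q⁺; x∈⁅x⁆;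
         ∣⁅x⁆∣≡1; x∈p∧x∉q⇒x∈p─q; p⊂q⇒∣p∣<∣q∣; x∈p⇒∣p-x∣<∣p∣; ∣p∣≤∣x∷p∣)
open import Data.Vec using ([]; _∷_; tabulate)
import Data.Vec.Base as Vec
open import Data.Vec.Properties using (∷-injectiveʳ; lookup∘tabulate; []=⇒lookup; lookup⇒[]=)
open import Data.List using (List; []; _∷_; length; map; _++_; lookup; cartesianProductWith)
open import Data.List.Properties using (length-++; length-map)
open import Data.List.Membership.Propositional using () renaming (_∈_ to _∈ₗ_)
open import Data.List.Membership.Propositional.Properties
  using (∈-map⁺; ∈-map⁻; ∈-++⁺ˡ; ∈-++⁺ʳ; ∈-lookup; ∈-cartesianProductWith⁺; ∈-filter⁻)
open import Data.List.Relation.Unary.Any as Any using (here; there)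
open import Data.List.Relation.Unary.Any.Properties using (lookup-index)
import Data.List.Relation.Unary.All as All
open import Data.List.Relation.Unary.AllPairs using ([]; _∷_)
open import Data.List.Relation.Unary.Unique.Propositional using (Unique)
import Data.List.Relation.Unary.Unique.Propositional.Properties as Unique
open import Data.Product using (∃-syntax; _×_; _,_; proj₁; proj₂)
open import Data.Sum using (inj₁; inj₂)
open import Relation.Binary.PropositionalEquality
  using (_≡_; _≢_; refl; sym; trans; cong; cong₂; subst; module ≡-Reasoning)
open import Relation.Binary.Definitions using (tri<; tri≈; tri>)
open import Relation.Binary.Structures using (IsDecEquivalence)
open import Relation.Nullary using (Dec; yes; no; does; ¬_; _×-dec_; contradiction)
open import Relation.Nullary.Decidable using (dec-true; decidable-stable; ¬?; _→-dec_)
open import Induction.WellFounded using (Acc; acc)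
open import Algebra.Structures using (IsGroup)

module _ {A : Set} where

  lookup-injective : ∀ {xs : List A} → Unique xs → ∀ i j → lookup xs i ≡ lookup xs j → i ≡ j
  lookup-injective (_ ∷ _)     zero    zero    _  = refl
  lookup-injective (x∉xs ∷ _)  zero    (suc j) eq = contradiction eq (All.lookup x∉xs (∈-lookup j))
  lookup-injective (x∉xs ∷ _)  (suc i) zero    eq = contradiction (sym eq) (All.lookup x∉xs (∈-lookup i))
  lookup-injective (_ ∷ uniq)  (suc i) (suc j) eq = cong suc (lookup-injective uniq i j eq)

  length-≤-injectiveOn : ∀ {B : Set} (f : A → B) {xs ys} → Unique xs →
    (∀ {x} → x ∈ₗ xs → f x ∈ₗ ys) →
    (∀ {x y} → x ∈ₗ xs → y ∈ₗ xs → f x ≡ f y → x ≡ y) →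
    length xs ≤ length ys
  length-≤-injectiveOn f {xs} {ys} uniq into inj = FinP.injective⇒≤ index-injective
    where
    index : Fin (length xs) → Fin (length ys)
    index i = Any.index (into (∈-lookup i))

    index-injective : ∀ {i j} → index i ≡ index j → i ≡ j
    index-injective {i} {j} eq = lookup-injective uniq i j (inj (∈-lookup i) (∈-lookup j) (begin
      f (lookup xs i)      ≡⟨ lookup-index (into (∈-lookup i)) ⟩
      lookup ys (index i)  ≡⟨ cong (lookup ys) eq ⟩
      lookup ys (index j)  ≡⟨ lookup-index (into (∈-lookup j)) ⟨
      f (lookup xs j)      ∎))
      where open ≡-Reasoning

length-≤-⊆ : ∀ {A : Set} {xs ys : List A} → Unique xs → (∀ {x} → x ∈ₗ xs → x ∈ₗ ys) →
  length xs ≤ length ys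
length-≤-⊆ uniq xs⊆ys = length-≤-injectiveOn (λ x → x) uniq xs⊆ys (λ _ _ eq → eq)

length-cartesianProductWith : ∀ {A B C : Set} (f : A → B → C) xs ys →
  length (cartesianProductWith f xs ys) ≡ length xs * length ys
length-cartesianProductWith f []       ys = refl
length-cartesianProductWith f (x ∷ xs) ys = begin
  length (map (f x) ys ++ cartesianProductWith f xs ys)
    ≡⟨ length-++ (map (f x) ys) ⟩
  length (map (f x) ys) + length (cartesianProductWith f xs ys)
    ≡⟨ cong₂ _+_ (length-map (f x) ys) (length-cartesianProductWith f xs ys) ⟩
  length ys + length xs * length ys ∎
  where open ≡-Reasoning

elements : ∀ {n} → Subset n → List (Fin n)
elements []          = []
elements (true  ∷ p) = zero ∷ map suc (elements p)
elements (false ∷ p) = map suc (elements p)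

length-elements : ∀ {n} (p : Subset n) → length (elements p) ≡ ∣ p ∣
length-elements []          = refl
length-elements (true  ∷ p) = cong suc (trans (length-map suc (elements p)) (length-elements p))
length-elements (false ∷ p) = trans (length-map suc (elements p)) (length-elements p)

∈-elements⁺ : ∀ {n} {p : Subset n} {i} → i ∈ p → i ∈ₗ elements p
∈-elements⁺ {p = true  ∷ p} Vec.here        = here refl
∈-elements⁺ {p = true  ∷ p} (Vec.there i∈p) = there (∈-map⁺ suc (∈-elements⁺ i∈p))
∈-elements⁺ {p = false ∷ p} (Vec.there i∈p) = ∈-map⁺ suc (∈-elements⁺ i∈p)

∈-elements⁻ : ∀ {n} {p : Subset n} {i} → i ∈ₗ elements p → i ∈ p
∈-elements⁻ {p = true  ∷ p} (here refl) = Vec.here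
∈-elements⁻ {p = true  ∷ p} (there i∈) with ∈-map⁻ suc i∈
... | _ , j∈ , refl = Vec.there (∈-elements⁻ j∈)
∈-elements⁻ {p = false ∷ p} i∈ with ∈-map⁻ suc i∈
... | _ , j∈ , refl = Vec.there (∈-elements⁻ j∈)

elements-unique : ∀ {n} (p : Subset n) → Unique (elements p)
elements-unique []          = []
elements-unique (true  ∷ p) = All.tabulate zero∉ ∷ Unique.map⁺ FinP.suc-injective (elements-unique p)
  where
  zero∉ : ∀ {i} → i ∈ₗ map suc (elements p) → zero ≢ i
  zero∉ i∈ refl with ∈-map⁻ suc i∈
  ... | _ , _ , ()
elements-unique (false ∷ p) = Unique.map⁺ FinP.suc-injective (elements-unique p)

subsetsOf : ∀ {n} → Subset n → List (Subset n)
subsetsOf []          = [] ∷ []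
subsetsOf (true  ∷ p) = map (true ∷_) (subsetsOf p) ++ map (false ∷_) (subsetsOf p)
subsetsOf (false ∷ p) = map (false ∷_) (subsetsOf p)

length-subsetsOf : ∀ {n} (p : Subset n) → length (subsetsOf p) ≡ 2 ^ ∣ p ∣
length-subsetsOf []          = refl
length-subsetsOf (true  ∷ p) = begin
  length (map (true ∷_) (subsetsOf p) ++ map (false ∷_) (subsetsOf p))
    ≡⟨ length-++ (map (true ∷_) (subsetsOf p)) ⟩
  length (map (true ∷_) (subsetsOf p)) + length (map (false ∷_) (subsetsOf p))
    ≡⟨ cong₂ _+_ (length-map (true ∷_) (subsetsOf p)) (length-map (false ∷_) (subsetsOf p)) ⟩
  length (subsetsOf p) + length (subsetsOf p)
    ≡⟨ cong (λ k → k + k) (length-subsetsOf p) ⟩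
  2 ^ ∣ p ∣ + 2 ^ ∣ p ∣
    ≡⟨ cong (2 ^ ∣ p ∣ +_) (ℕ.+-identityʳ (2 ^ ∣ p ∣)) ⟨
  2 * 2 ^ ∣ p ∣ ∎
  where open ≡-Reasoning
length-subsetsOf (false ∷ p) = trans (length-map (false ∷_) (subsetsOf p)) (length-subsetsOf p)

⊆⇒∈-subsetsOf : ∀ {n} {p q : Subset n} → q ⊆ p → q ∈ₗ subsetsOf p
⊆⇒∈-subsetsOf {p = []}        {[]}        _   = here refl
⊆⇒∈-subsetsOf {p = true  ∷ p} {true  ∷ q} q⊆p =
  ∈-++⁺ˡ (∈-map⁺ (true ∷_) (⊆⇒∈-subsetsOf (drop-∷-⊆ q⊆p)))
⊆⇒∈-subsetsOf {p = true  ∷ p} {false ∷ q} q⊆p =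
  ∈-++⁺ʳ (map (true ∷_) (subsetsOf p)) (∈-map⁺ (false ∷_) (⊆⇒∈-subsetsOf (drop-∷-⊆ q⊆p)))
⊆⇒∈-subsetsOf {p = false ∷ p} {true  ∷ q} q⊆p with q⊆p Vec.here
... | ()
⊆⇒∈-subsetsOf {p = false ∷ p} {false ∷ q} q⊆p = ∈-map⁺ (false ∷_) (⊆⇒∈-subsetsOf (drop-∷-⊆ q⊆p))

allSubsets-unique : ∀ n → Unique (allSubsets n)
allSubsets-unique zero    = All.[] ∷ []
allSubsets-unique (suc n) =
  Unique.++⁺ (Unique.map⁺ ∷-injectiveʳ (allSubsets-unique n))
             (Unique.map⁺ ∷-injectiveʳ (allSubsets-unique n)) disjoint
  where
  disjoint : ∀ {p} → ¬ (p ∈ₗ map (true ∷_) (allSubsets n) × p ∈ₗ map (false ∷_) (allSubsets n))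
  disjoint (p∈ , p∈′) with ∈-map⁻ (true ∷_) p∈ | ∈-map⁻ (false ∷_) p∈′
  ... | _ , _ , refl | _ , _ , ()

∣p─q∣+∣q∣≡∣p∣ : ∀ {n} (p q : Subset n) → q ⊆ p → ∣ p ─ q ∣ + ∣ q ∣ ≡ ∣ p ∣
∣p─q∣+∣q∣≡∣p∣ []          []          _   = refl
∣p─q∣+∣q∣≡∣p∣ (true  ∷ p) (true  ∷ q) q⊆p =
  trans (ℕ.+-suc ∣ p ─ q ∣ ∣ q ∣) (cong suc (∣p─q∣+∣q∣≡∣p∣ p q (drop-∷-⊆ q⊆p)))
∣p─q∣+∣q∣≡∣p∣ (true  ∷ p) (false ∷ q) q⊆p = cong suc (∣p─q∣+∣q∣≡∣p∣ p q (drop-∷-⊆ q⊆p))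
∣p─q∣+∣q∣≡∣p∣ (false ∷ p) (true  ∷ q) q⊆p with q⊆p Vec.here
... | ()
∣p─q∣+∣q∣≡∣p∣ (false ∷ p) (false ∷ q) q⊆p = ∣p─q∣+∣q∣≡∣p∣ p q (drop-∷-⊆ q⊆p)

∣p∪q∣≤∣p∣+∣q∣ : ∀ {n} (p q : Subset n) → ∣ p ∪ q ∣ ≤ ∣ p ∣ + ∣ q ∣
∣p∪q∣≤∣p∣+∣q∣ []          []          = z≤n
∣p∪q∣≤∣p∣+∣q∣ (true  ∷ p) (s     ∷ q) =
  s≤s (ℕ.≤-trans (∣p∪q∣≤∣p∣+∣q∣ p q) (ℕ.+-monoʳ-≤ ∣ p ∣ (∣p∣≤∣x∷p∣ s q)))
∣p∪q∣≤∣p∣+∣q∣ (false ∷ p) (true  ∷ q) =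
  ℕ.≤-trans (s≤s (∣p∪q∣≤∣p∣+∣q∣ p q)) (ℕ.≤-reflexive (sym (ℕ.+-suc ∣ p ∣ ∣ q ∣)))
∣p∪q∣≤∣p∣+∣q∣ (false ∷ p) (false ∷ q) = ∣p∪q∣≤∣p∣+∣q∣ p q

module _ {n} {f : Fin n → Bool} where

  ∈-tabulate⁺ : ∀ {i} → f i ≡ true → i ∈ tabulate f
  ∈-tabulate⁺ {i} fi≡ = lookup⇒[]= i _ (trans (lookup∘tabulate f i) fi≡)

  ∈-tabulate⁻ : ∀ {i} → i ∈ tabulate f → f i ≡ true
  ∈-tabulate⁻ {i} i∈ = trans (sym (lookup∘tabulate f i)) ([]=⇒lookup i∈)

  ∉-tabulate : ∀ {i} → i ∉ tabulate f → f i ≡ false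
  ∉-tabulate {i} i∉ with f i in fi≡
  ... | false = refl
  ... | true  = contradiction (∈-tabulate⁺ fi≡) i∉

module _ {n} {P : Fin n → Set} (P? : ∀ i → Dec (P i)) where

  ∈-tabulate-does⁺ : ∀ {i} → P i → i ∈ tabulate (λ j → does (P? j))
  ∈-tabulate-does⁺ {i} pi = ∈-tabulate⁺ (dec-true (P? i) pi)

  ∈-tabulate-does⁻ : ∀ {i} → i ∈ tabulate (λ j → does (P? j)) → P i
  ∈-tabulate-does⁻ {i} i∈ with P? i | ∈-tabulate⁻ i∈
  ... | yes pi | _ = pi
  ... | no  _  | ()

module Transversal {n} {_~_ : Fin n → Fin n → Set} (~-isDecEquivalence : IsDecEquivalence _~_)
                  (D : Subset n) (D-closed : ∀ {g h} → g ∈ D → g ~ h → h ∈ D) where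

  open IsDecEquivalence ~-isDecEquivalence using ()
    renaming (_≟_ to _~?_; refl to ~-refl; sym to ~-sym; trans to ~-trans)

  Minimal : Fin n → Set
  Minimal g = ∀ h → h Fin.< g → ¬ g ~ h

  minimal? : ∀ g → Dec (Minimal g)
  minimal? g = FinP.all? λ h → (h FinP.<? g) →-dec ¬? (g ~? h)

  minimalRepresentative : ∀ g → ∃[ m ] g ~ m × Minimal m
  minimalRepresentative g = go g (<-wellFounded g)
    where
    go : ∀ g → Acc Fin._<_ g → ∃[ m ] g ~ m × Minimal m
    go g (acc smaller) with FinP.any? (λ h → (h FinP.<? g) ×-dec (g ~? h))
    ... | yes (h , h<g , g~h) =
      let m , h~m , m-minimal = go h (smaller h<g) in m , ~-trans g~h h~m , m-minimal
    ... | no ∄h = g , ~-refl , λ h h<g g~h → ∄h (h , h<g , g~h)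

  minimal-unique : ∀ {m m′} → Minimal m → Minimal m′ → m ~ m′ → m ≡ m′
  minimal-unique {m} {m′} m-minimal m′-minimal m~m′ with FinP.<-cmp m m′
  ... | tri< m<m′ _ _ = contradiction (~-sym m~m′) (m′-minimal m m<m′)
  ... | tri≈ _ m≡m′ _ = m≡m′
  ... | tri> _ _ m′<m = contradiction m~m′ (m-minimal m′ m′<m)

  transversal? : ∀ g → Dec (g ∈ D × Minimal g)
  transversal? g = (g ∈? D) ×-dec minimal? g

  transversal : Subset n
  transversal = tabulate λ g → does (transversal? g)

  transversal⊆D : transversal ⊆ D
  transversal⊆D m∈ = proj₁ (∈-tabulate-does⁻ transversal? m∈)

  transversal-unique : ∀ {m m′} → m ∈ transversal → m′ ∈ transversal → m ~ m′ → m ≡ m′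
  transversal-unique m∈ m′∈ =
    minimal-unique (proj₂ (∈-tabulate-does⁻ transversal? m∈)) (proj₂ (∈-tabulate-does⁻ transversal? m′∈))

  representative : ∀ {g} → g ∈ D → ∃[ m ] m ∈ transversal × g ~ m
  representative {g} g∈D =
    let m , g~m , m-minimal = minimalRepresentative g
    in  m , ∈-tabulate-does⁺ transversal? (D-closed g∈D g~m , m-minimal) , g~m

module EvenFamilies {n} {_~_ : Fin n → Fin n → Set} (~-isDecEquivalence : IsDecEquivalence _~_)
                    (D : Subset n) (D-closed : ∀ {g h} → g ∈ D → g ~ h → h ∈ D)
                    (block : Fin n → Subset n)
                    (∈-block⁺ : ∀ {g h} → g ~ h → h ∈ block g)
                    (∈-block⁻ : ∀ {g h} → h ∈ block g → g ~ h) where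

  open Transversal ~-isDecEquivalence D D-closed
  open IsDecEquivalence ~-isDecEquivalence using () renaming (refl to ~-refl)

  IntersectsBlocksEvenly : Subset n → Set
  IntersectsBlocksEvenly S = ∀ g h → g ∈ D → h ∈ D → ∣ S ∩ block g ∣ ≡ ∣ S ∩ block h ∣

  module _ {x} (x∈D : x ∈ D) where

    m₀ : Fin n
    m₀ = proj₁ (representative x∈D)

    m₀∈transversal : m₀ ∈ transversal
    m₀∈transversal = proj₁ (proj₂ (representative x∈D))

    T : Subset n
    T = (D ─ transversal) ∪ ⁅ m₀ ⁆

    ∣T∣≤∣D∣∸∣transversal∣+1 : ∣ T ∣ ≤ ∣ D ∣ ∸ ∣ transversal ∣ + 1
    ∣T∣≤∣D∣∸∣transversal∣+1 = ℕ.≤-trans (∣p∪q∣≤∣p∣+∣q∣ (D ─ transversal) ⁅ m₀ ⁆)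
      (ℕ.≤-reflexive (cong₂ _+_ ∣D─transversal∣≡ (∣⁅x⁆∣≡1 m₀)))
      where
      ∣D─transversal∣≡ : ∣ D ─ transversal ∣ ≡ ∣ D ∣ ∸ ∣ transversal ∣
      ∣D─transversal∣≡ = trans (sym (ℕ.m+n∸n≡m _ ∣ transversal ∣))
        (cong (_∸ ∣ transversal ∣) (∣p─q∣+∣q∣≡∣p∣ D transversal transversal⊆D))

    ∈T⁺ : ∀ {h} → h ∈ D → (h ∈ transversal → h ≡ m₀) → h ∈ T
    ∈T⁺ {h} h∈D only-m₀ with h ∈? transversal
    ... | yes h∈ = subst (_∈ T) (sym (only-m₀ h∈)) (x∈p∪q⁺ (inj₂ (x∈⁅x⁆ m₀)))
    ... | no  h∉ = x∈p∪q⁺ (inj₁ (x∈p∧x∉q⇒x∈p─q h∈D h∉))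

    block-m₀⊆T : ∀ {h} → h ∈ D → h ∈ block m₀ → h ∈ T
    block-m₀⊆T h∈D h∈ = ∈T⁺ h∈D λ h∈transversal →
      sym (transversal-unique m₀∈transversal h∈transversal (∈-block⁻ h∈))

    block-─⊆T : ∀ {m h} → m ∈ transversal → h ∈ D → h ∈ block m → h ≢ m → h ∈ T
    block-─⊆T m∈ h∈D h∈ h≢m = ∈T⁺ h∈D λ h∈transversal →
      contradiction (sym (transversal-unique m∈ h∈transversal (∈-block⁻ h∈))) h≢m

    agree-on-T : ∀ {S S′ h} → S ∩ T ≡ S′ ∩ T → h ∈ T → h ∈ S → h ∈ S′
    agree-on-T {S′ = S′} {h} eq h∈T h∈S = proj₁ (x∈p∩q⁻ S′ T (subst (h ∈_) eq (x∈p∩q⁺ (h∈S , h∈T))))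

    ∩-block-m₀-⊆ : ∀ {S S′} → S ⊆ D → S ∩ T ≡ S′ ∩ T → S ∩ block m₀ ⊆ S′ ∩ block m₀
    ∩-block-m₀-⊆ {S} S⊆D eq h∈ =
      let h∈S , h∈block = x∈p∩q⁻ S _ h∈
      in  x∈p∩q⁺ (agree-on-T eq (block-m₀⊆T (S⊆D h∈S) h∈block) h∈S , h∈block)

    ∩T≡⇒⊆ : ∀ {S S′} → S ⊆ D → S′ ⊆ D → IntersectsBlocksEvenly S → IntersectsBlocksEvenly S′ →
      S ∩ T ≡ S′ ∩ T → S ⊆ S′
    ∩T≡⇒⊆ {S} {S′} S⊆D S′⊆D S-even S′-even eq {g} g∈S with g ∈? S′
    ... | yes g∈S′ = g∈S′
    ... | no  g∉S′ = contradiction counts-equal (ℕ.<⇒≢ counts-differ)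
      where
      g∈D : g ∈ D
      g∈D = S⊆D g∈S

      g∈transversal : g ∈ transversal
      g∈transversal = decidable-stable (g ∈? transversal) λ g∉ →
        g∉S′ (agree-on-T eq (∈T⁺ g∈D λ g∈ → contradiction g∈ g∉) g∈S)

      m₀∈D : m₀ ∈ D
      m₀∈D = transversal⊆D m₀∈transversal

      counts-equal : ∣ S′ ∩ block g ∣ ≡ ∣ S ∩ block g ∣
      counts-equal = begin
        ∣ S′ ∩ block g ∣   ≡⟨ S′-even g m₀ g∈D m₀∈D ⟩
        ∣ S′ ∩ block m₀ ∣  ≡⟨ cong ∣_∣ (⊆-antisym (∩-block-m₀-⊆ S′⊆D (sym eq)) (∩-block-m₀-⊆ S⊆D eq)) ⟩
        ∣ S ∩ block m₀ ∣   ≡⟨ S-even m₀ g m₀∈D g∈D ⟩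
        ∣ S ∩ block g ∣    ∎
        where open ≡-Reasoning

      S′∩block⊆S∩block : S′ ∩ block g ⊆ S ∩ block g
      S′∩block⊆S∩block {h} h∈ =
        x∈p∩q⁺ (agree-on-T (sym eq) (block-─⊆T g∈transversal (S′⊆D h∈S′) h∈block h≢g) h∈S′ , h∈block)
        where
        h∈S′ : h ∈ S′
        h∈S′ = proj₁ (x∈p∩q⁻ S′ _ h∈)

        h∈block : h ∈ block g
        h∈block = proj₂ (x∈p∩q⁻ S′ _ h∈)

        h≢g : h ≢ g
        h≢g refl = g∉S′ h∈S′

      counts-differ : ∣ S′ ∩ block g ∣ < ∣ S ∩ block g ∣
      counts-differ = p⊂q⇒∣p∣<∣q∣
        (S′∩block⊆S∩block , g , x∈p∩q⁺ (g∈S , ∈-block⁺ ~-refl) , λ g∈ → g∉S′ (proj₁ (x∈p∩q⁻ S′ _ g∈)))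

    length-evenFamily≤ : (𝒮 : List (Subset n)) → Unique 𝒮 →
      (∀ {S} → S ∈ₗ 𝒮 → S ⊆ D × IntersectsBlocksEvenly S) →
      length 𝒮 ≤ 2 ^ (∣ D ∣ ∸ ∣ transversal ∣ + 1)
    length-evenFamily≤ 𝒮 uniq even = begin
      length 𝒮
        ≤⟨ length-≤-injectiveOn (_∩ T) uniq restriction∈ restriction-injective ⟩
      length (subsetsOf T)
        ≡⟨ length-subsetsOf T ⟩
      2 ^ ∣ T ∣
        ≤⟨ ℕ.^-monoʳ-≤ 2 ∣T∣≤∣D∣∸∣transversal∣+1 ⟩
      2 ^ (∣ D ∣ ∸ ∣ transversal ∣ + 1) ∎
      where
      open ℕ.≤-Reasoning

      restriction∈ : ∀ {S} → S ∈ₗ 𝒮 → S ∩ T ∈ₗ subsetsOf T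
      restriction∈ {S} _ = ⊆⇒∈-subsetsOf (p∩q⊆q S T)

      restriction-injective : ∀ {S S′} → S ∈ₗ 𝒮 → S′ ∈ₗ 𝒮 → S ∩ T ≡ S′ ∩ T → S ≡ S′
      restriction-injective S∈ S′∈ eq with even S∈ | even S′∈
      ... | S⊆D , S-even | S′⊆D , S′-even = ⊆-antisym
        (∩T≡⇒⊆ S⊆D S′⊆D S-even S′-even eq) (∩T≡⇒⊆ S′⊆D S⊆D S′-even S-even (sym eq))

module Cosets {n} (R : FinGroup n) (Q : Subset n) (Q-subgroup : IsSubgroup R Q) where

  open FinGroup R
  open IsGroup isGroup using (assoc; identityˡ; identityʳ; inverseˡ)
  open IsSubgroup Q-subgroup

  _~_ : Fin n → Fin n → Set
  g ~ h = ∃[ q ] q ∈ Q × q ∙ g ≡ h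

  _~?_ : ∀ g h → Dec (g ~ h)
  g ~? h = FinP.any? λ q → (q ∈? Q) ×-dec (q ∙ g FinP.≟ h)

  ∈-rightCoset⁻ : ∀ {g h} → h ∈ rightCoset R Q g → g ~ h
  ∈-rightCoset⁻ {g} {h} h∈ with g ~? h | ∈-tabulate⁻ h∈
  ... | yes g~h | _ = g~h
  ... | no  _   | ()

  ∈-rightCoset⁺ : ∀ {g h} → g ~ h → h ∈ rightCoset R Q g
  ∈-rightCoset⁺ {g} {h} g~h with h ∈? rightCoset R Q g
  ... | yes h∈ = h∈
  ... | no  h∉ with g ~? h | ∉-tabulate h∉
  ...   | yes _    | ()
  ...   | no  g≁h | _ = contradiction g~h g≁h

  ~-refl : ∀ {g} → g ~ g
  ~-refl {g} = ε , ε∈ , identityˡ g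

  ~-sym : ∀ {g h} → g ~ h → h ~ g
  ~-sym {g} {h} (q , q∈Q , qg≡h) = q ⁻¹ , ⁻¹-closed q∈Q , (begin
    (q ⁻¹) ∙ h         ≡⟨ cong ((q ⁻¹) ∙_) qg≡h ⟨
    (q ⁻¹) ∙ (q ∙ g)   ≡⟨ assoc (q ⁻¹) q g ⟨
    ((q ⁻¹) ∙ q) ∙ g   ≡⟨ cong (_∙ g) (inverseˡ q) ⟩
    ε ∙ g              ≡⟨ identityˡ g ⟩
    g                  ∎)
    where open ≡-Reasoning

  ~-trans : ∀ {g h k} → g ~ h → h ~ k → g ~ k
  ~-trans {g} {h} {k} (q , q∈Q , qg≡h) (q′ , q′∈Q , q′h≡k) = q′ ∙ q , ∙-closed q′∈Q q∈Q , (begin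
    (q′ ∙ q) ∙ g  ≡⟨ assoc q′ q g ⟩
    q′ ∙ (q ∙ g)  ≡⟨ cong (q′ ∙_) qg≡h ⟩
    q′ ∙ h        ≡⟨ q′h≡k ⟩
    k             ∎)
    where open ≡-Reasoning

  ~-isDecEquivalence : IsDecEquivalence _~_
  ~-isDecEquivalence = record
    { isEquivalence = record { refl = ~-refl ; sym = ~-sym ; trans = ~-trans }
    ; _≟_ = _~?_
    }

  module _ (x : Fin n) where

    InDoubleCoset : Fin n → Set
    InDoubleCoset g = ∃[ q₁ ] ∃[ q₂ ] q₁ ∈ Q × q₂ ∈ Q × (q₁ ∙ x) ∙ q₂ ≡ g

    inDoubleCoset? : ∀ g → Dec (InDoubleCoset g)
    inDoubleCoset? g = FinP.any? λ q₁ → FinP.any? λ q₂ →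
      (q₁ ∈? Q) ×-dec ((q₂ ∈? Q) ×-dec ((q₁ ∙ x) ∙ q₂ FinP.≟ g))

    ∈-doubleCoset⁻ : ∀ {g} → g ∈ doubleCoset R Q x → InDoubleCoset g
    ∈-doubleCoset⁻ {g} g∈ with inDoubleCoset? g | ∈-tabulate⁻ g∈
    ... | yes g∈QxQ | _ = g∈QxQ
    ... | no  _     | ()

    ∈-doubleCoset⁺ : ∀ {g} → InDoubleCoset g → g ∈ doubleCoset R Q x
    ∈-doubleCoset⁺ {g} g∈QxQ with g ∈? doubleCoset R Q x
    ... | yes g∈ = g∈
    ... | no  g∉ with inDoubleCoset? g | ∉-tabulate g∉
    ...   | yes _     | ()
    ...   | no  g∉QxQ | _ = contradiction g∈QxQ g∉QxQ

    x∈doubleCoset : x ∈ doubleCoset R Q x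
    x∈doubleCoset = ∈-doubleCoset⁺ (ε , ε , ε∈ , ε∈ , trans (identityʳ (ε ∙ x)) (identityˡ x))

    doubleCoset-closed : ∀ {g h} → g ∈ doubleCoset R Q x → g ~ h → h ∈ doubleCoset R Q x
    doubleCoset-closed {g} {h} g∈ (q , q∈Q , qg≡h) with ∈-doubleCoset⁻ g∈
    ... | q₁ , q₂ , q₁∈Q , q₂∈Q , q₁xq₂≡g = ∈-doubleCoset⁺ (q ∙ q₁ , q₂ , ∙-closed q∈Q q₁∈Q , q₂∈Q , (begin
      ((q ∙ q₁) ∙ x) ∙ q₂  ≡⟨ cong (_∙ q₂) (assoc q q₁ x) ⟩
      (q ∙ (q₁ ∙ x)) ∙ q₂  ≡⟨ assoc q (q₁ ∙ x) q₂ ⟩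
      q ∙ ((q₁ ∙ x) ∙ q₂)  ≡⟨ cong (q ∙_) q₁xq₂≡g ⟩
      q ∙ g                ≡⟨ qg≡h ⟩
      h                    ∎))
      where open ≡-Reasoning

    open Transversal ~-isDecEquivalence (doubleCoset R Q x) doubleCoset-closed

    ∣doubleCoset∣≤∣Q∣*∣transversal∣ : ∣ doubleCoset R Q x ∣ ≤ ∣ Q ∣ * ∣ transversal ∣
    ∣doubleCoset∣≤∣Q∣*∣transversal∣ = begin
      ∣ doubleCoset R Q x ∣
        ≡⟨ length-elements (doubleCoset R Q x) ⟨
      length (elements (doubleCoset R Q x))
        ≤⟨ length-≤-⊆ (elements-unique (doubleCoset R Q x)) doubleCoset⊆products ⟩
      length (cartesianProductWith _∙_ (elements Q) (elements transversal))
        ≡⟨ length-cartesianProductWith _∙_ (elements Q) (elements transversal) ⟩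
      length (elements Q) * length (elements transversal)
        ≡⟨ cong₂ _*_ (length-elements Q) (length-elements transversal) ⟩
      ∣ Q ∣ * ∣ transversal ∣ ∎
      where
      open ℕ.≤-Reasoning

      doubleCoset⊆products : ∀ {g} → g ∈ₗ elements (doubleCoset R Q x) →
        g ∈ₗ cartesianProductWith _∙_ (elements Q) (elements transversal)
      doubleCoset⊆products g∈ with representative (∈-elements⁻ g∈)
      ... | m , m∈ , g~m with ~-sym g~m
      ... | q , q∈Q , qm≡g =
        subst (_∈ₗ _) qm≡g (∈-cartesianProductWith⁺ _∙_ (∈-elements⁺ q∈Q) (∈-elements⁺ m∈))

    ≤∣transversal∣ : ∀ b → ∣ doubleCoset R Q x ∣ ≡ b * ∣ Q ∣ → b ≤ ∣ transversal ∣
    ≤∣transversal∣ b ∣QxQ∣≡b∣Q∣ = ℕ.*-cancelʳ-≤ b ∣ transversal ∣ ∣ Q ∣ {{>-nonZero ∣Q∣>0}} (begin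
      b * ∣ Q ∣                ≡⟨ ∣QxQ∣≡b∣Q∣ ⟨
      ∣ doubleCoset R Q x ∣    ≤⟨ ∣doubleCoset∣≤∣Q∣*∣transversal∣ ⟩
      ∣ Q ∣ * ∣ transversal ∣  ≡⟨ ℕ.*-comm ∣ Q ∣ ∣ transversal ∣ ⟩
      ∣ transversal ∣ * ∣ Q ∣  ∎)
      where
      open ℕ.≤-Reasoning

      ∣Q∣>0 : 0 < ∣ Q ∣
      ∣Q∣>0 = ℕ.≤-<-trans z≤n (x∈p⇒∣p-x∣<∣p∣ ε∈)

lemma3p5 : {n : ℕ} (R : FinGroup n) (Q : Subset n) → IsSubgroup R Q →
    (x : Fin n) (b : ℕ) → ∣ doubleCoset R Q x ∣ ≡ b * ∣ Q ∣ →
    length (evenSubsets R Q x) ≤ 2 ^ (∣ doubleCoset R Q x ∣ ∸ b + 1)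
lemma3p5 {n} R Q Q-subgroup x b ∣QxQ∣≡b∣Q∣ = begin
  length (evenSubsets R Q x)
    ≤⟨ length-evenFamily≤ (x∈doubleCoset x) (evenSubsets R Q x) unique even ⟩
  2 ^ (∣ QxQ ∣ ∸ ∣ transversal ∣ + 1)
    ≤⟨ ℕ.^-monoʳ-≤ 2 (ℕ.+-monoˡ-≤ 1 (ℕ.∸-monoʳ-≤ ∣ QxQ ∣ b≤∣transversal∣)) ⟩
  2 ^ (∣ QxQ ∣ ∸ b + 1) ∎
  where
  open ℕ.≤-Reasoning
  open Cosets R Q Q-subgroup
  open EvenFamilies ~-isDecEquivalence (doubleCoset R Q x) (doubleCoset-closed x)
                    (rightCoset R Q) ∈-rightCoset⁺ ∈-rightCoset⁻
  open Transversal ~-isDecEquivalence (doubleCoset R Q x) (doubleCoset-closed x) using (transversal)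

  QxQ : Subset n
  QxQ = doubleCoset R Q x

  even? : ∀ S → Dec (S ⊆ QxQ × IntersectsEvenly R Q x S)
  even? S = (S ⊆? QxQ) ×-dec intersectsEvenly? R Q x S

  unique : Unique (evenSubsets R Q x)
  unique = Unique.filter⁺ even? (allSubsets-unique n)

  even : ∀ {S} → S ∈ₗ evenSubsets R Q x → S ⊆ QxQ × IntersectsBlocksEvenly S
  even S∈ = proj₂ (∈-filter⁻ even? {xs = allSubsets n} S∈)

  b≤∣transversal∣ : b ≤ ∣ transversal ∣
  b≤∣transversal∣ = ≤∣transversal∣ x b ∣QxQ∣≡b∣Q∣
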